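{- Fix an integer $t>1$, let $\mathcal B\subseteq\mathcal U$ be the subalgebra generated by $u_t$ and $d_t$, let $I_{\mathcal B}=I\cap\mathcal B$, and let $J_{\mathcal B}$ be the two-sided ideal of $\mathcal B$ generated by the elements \[ u_t^{i+1}d_t^{i}-u_t^{i+1}d_t^{i+1}u_t\quad\text{and}\quad u_t^{i}d_t^{i+1}-d_tu_t^{i+1}d_t^{i+1}\qquad (i\ge0). \] Then $J_{\mathcal B}\subseteq I_{\mathcal B}$.
   Context: A partition is a nonincreasing sequence of nonnegative integers with finite sum; $\lambda'_i$ denotes the number of boxes in column $i$. $\mathbf Y$ is the set of partitions, $\mathbf C[\mathbf Y]$ the vector space with basis $\mathbf Y$. $\mathcal U$ is the free associative $\mathbf C$-algebra on generators $u_i,d_i$ ($i\ge1$), acting on $\mathbf C[\mathbf Y]$ (products as compositions): $u_i(\lambda)$ is the partition obtained by adding a box to column $i$ if that is a partition, else $0$; $d_i(\lambda)$ is the partition obtained by removing a box from column $i$ if that is a partition, else $0$. $I$ is the two-sided ideal of elements of $\mathcal U$ acting as zero on $\mathbf C[\mathbf Y]$. $u_t^0=d_t^0=1$. -}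

module Defs where

open import Level using (Level)
open import Data.Nat using (ℕ; zero; suc; _<_; _≥_; _≥?_; _<?_)
import Data.Nat.Properties as ℕP
open import Data.List using (List; []; _∷_; _++_; replicate; concatMap)
open import Data.List.Relation.Unary.All using (All; all?)
open import Data.List.Relation.Unary.Linked using (Linked; linked?)
import Data.List.Properties as ListP
import Data.Maybe.Properties as MaybeP
open import Data.Maybe using (Maybe; just; nothing; _>>=_)
import Data.Maybe as Maybe
open import Data.Product using (_×_; _,_)
open import Relation.Nullary using (yes; no; _×-dec_)
open import Relation.Binary.PropositionalEquality using (_≡_)
open import Algebra.Bundles using (CommutativeRing)

-- Partitions, represented by their column lengths λ'₁ ≥ λ'₂ ≥ … > 0
-- (trailing zero columns omitted).  Column i (1-based) is the i-th entry.

IsPartition : List ℕ → Set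
IsPartition cs = All (0 <_) cs × Linked _≥_ cs

isPartition? : (cs : List ℕ) → Relation.Nullary.Dec (IsPartition cs)
isPartition? cs = all? (0 <?_) cs ×-dec linked? _≥?_ cs

check : List ℕ → Maybe (List ℕ)
check cs with isPartition? cs
... | yes _ = just cs
... | no  _ = nothing

trim : List ℕ → List ℕ
trim [] = []
trim (c ∷ cs) with trim cs
... | [] with c
...   | zero  = []
...   | suc k = suc k ∷ []
trim (c ∷ cs) | r ∷ rs = c ∷ r ∷ rs

-- add one box to column i (1-based); absent columns count as length 0
incCol : ℕ → List ℕ → List ℕ
incCol zero cs = cs
incCol (suc zero) [] = 1 ∷ []
incCol (suc zero) (c ∷ cs) = suc c ∷ cs
incCol (suc (suc k)) [] = 0 ∷ incCol (suc k) []
incCol (suc (suc k)) (c ∷ cs) = c ∷ incCol (suc k) cs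

decCol : ℕ → List ℕ → Maybe (List ℕ)
decCol (suc zero) (suc c ∷ cs) = just (c ∷ cs)
decCol (suc (suc k)) (c ∷ cs) = Maybe.map (c ∷_) (decCol (suc k) cs)
decCol _ _ = nothing

-- u_i and d_i on a basis partition (nothing = the zero vector)
uOp : ℕ → List ℕ → Maybe (List ℕ)
uOp i cs = check (trim (incCol i cs))

dOp : ℕ → List ℕ → Maybe (List ℕ)
dOp i cs = decCol i cs >>= λ cs' → check (trim cs')

-- The subalgebra B generated by u_t, d_t: it is the free algebra on the
-- two letters U (= u_t) and D (= d_t).  Words are read as compositions.

data Letter : Set where
  U D : Letter

Word : Set
Word = List Letter

letterOp : ℕ → Letter → List ℕ → Maybe (List ℕ)
letterOp t U = uOp t
letterOp t D = dOp t

act : ℕ → Word → List ℕ → Maybe (List ℕ)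
act t [] cs = just cs
act t (l ∷ w) cs = act t w cs >>= letterOp t l

module _ {c ℓ : Level} (R : CommutativeRing c ℓ) where
  open CommutativeRing R

  -- elements of B (with coefficients in R): formal finite sums Σ r · w
  Elem : Set c
  Elem = List (Carrier × Word)

  _⊕_ : Elem → Elem → Elem
  f ⊕ g = f ++ g

  _⊗_ : Elem → Elem → Elem
  f ⊗ g = concatMap (λ { (r , v) → Data.List.map (λ { (s , w) → (r * s , v ++ w) }) g }) f

  coeff : ℕ → Elem → List ℕ → List ℕ → Carrier
  coeff t [] λ' μ = 0#
  coeff t ((r , w) ∷ f) λ' μ with MaybeP.≡-dec (ListP.≡-dec ℕP._≟_) (act t w λ') (just μ)
  ... | yes _ = r + coeff t f λ' μ
  ... | no  _ = coeff t f λ' μ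

  -- f acts as zero on C[Y] (i.e. f ∈ I, hence f ∈ I_B = I ∩ B)
  ActsAsZero : ℕ → Elem → Set ℓ
  ActsAsZero t f = ∀ λ' → IsPartition λ' → ∀ μ → coeff t f λ' μ ≈ 0#

  genA : ℕ → Elem
  genA i = (1# , replicate (suc i) U ++ replicate i D)
         ∷ (- 1# , replicate (suc i) U ++ replicate (suc i) D ++ (U ∷ []))
         ∷ []

  genB : ℕ → Elem
  genB i = (1# , replicate i U ++ replicate (suc i) D)
         ∷ (- 1# , D ∷ replicate (suc i) U ++ replicate (suc i) D)
         ∷ []

  data InJ : Elem → Set c where
    inA  : ∀ i → InJ (genA i)
    inB  : ∀ i → InJ (genB i)
    in0  : InJ []
    inAdd : ∀ {f g} → InJ f → InJ g → InJ (f ⊕ g)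
    inL  : ∀ a {f} → InJ f → InJ (a ⊗ f)
    inR  : ∀ {f} a → InJ f → InJ (f ⊗ a)

-- Adding and removing a box in a fixed column t ≥ 1 are mutually inverse partial
-- bijections of the set of partitions: u_t λ = μ iff d_t μ = λ.  Consequently the
-- two words of each generator of J_B send every partition to the same partition
-- (or both to 0): for u^{i+1} d^i versus u^{i+1} d^{i+1} u this is d u = id where
-- u is defined, and u^{i+1} d^i λ = 0 where u λ = 0; for u^i d^{i+1} versus
-- d u^{i+1} d^{i+1} it is u^{i+1} d^{i+1} = id where d^{i+1} is defined.  So the
-- generators act as zero, and the elements acting as zero form a two-sided ideal.
module Submission where

open import Defs
open import Level using (Level)
open import Data.Nat using (ℕ; zero; suc; _<_; s≤s; z≤n)
open import Data.List using (List; []; _∷_; _++_; replicate; map)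
open import Data.List.Relation.Unary.All using (All; []; _∷_)
open import Data.Maybe using (Maybe; just; nothing; _>>=_)
open import Data.Maybe.Relation.Unary.All as MaybeAll using (just; nothing)
import Data.Maybe.Properties as MaybeP
import Data.List.Properties as ListP
import Data.Nat.Properties as ℕP
open import Data.Product using (_×_; _,_; ∃; proj₁; proj₂)
open import Data.Empty using (⊥-elim)
open import Function using (_∘_)
open import Relation.Nullary using (yes; no)
open import Relation.Binary.PropositionalEquality
  using (_≡_; refl; sym; trans; cong; module ≡-Reasoning)
open import Algebra.Bundles using (CommutativeRing)

consTrimmed : ℕ → List ℕ → List ℕ
consTrimmed c (r ∷ rs)  = c ∷ r ∷ rs
consTrimmed zero []     = []
consTrimmed (suc c) []  = suc c ∷ []

trim-∷ : ∀ c cs → trim (c ∷ cs) ≡ consTrimmed c (trim cs)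
trim-∷ c cs with trim cs
... | [] with c
...   | zero  = refl
...   | suc _ = refl
trim-∷ c cs | _ ∷ _ = refl

trim-cong-∷ : ∀ c cs ds → trim cs ≡ trim ds → trim (c ∷ cs) ≡ trim (c ∷ ds)
trim-cong-∷ c cs ds eq rewrite trim-∷ c cs | trim-∷ c ds = cong (consTrimmed c) eq

consTrimmed-suc : ∀ c cs → consTrimmed (suc c) cs ≡ suc c ∷ cs
consTrimmed-suc c []      = refl
consTrimmed-suc c (_ ∷ _) = refl

trim-positive : ∀ {cs} → All (0 <_) cs → trim cs ≡ cs
trim-positive []                       = refl
trim-positive {suc c ∷ cs} (s≤s _ ∷ ps) = begin
  trim (suc c ∷ cs)              ≡⟨ trim-∷ (suc c) cs ⟩
  consTrimmed (suc c) (trim cs)  ≡⟨ cong (consTrimmed (suc c)) (trim-positive ps) ⟩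
  consTrimmed (suc c) cs         ≡⟨ consTrimmed-suc c cs ⟩
  suc c ∷ cs                     ∎
  where open ≡-Reasoning

trim-consTrimmed : ∀ c cs → trim cs ≡ cs → trim (consTrimmed c cs) ≡ consTrimmed c cs
trim-consTrimmed zero    []       _  = refl
trim-consTrimmed (suc _) []       _  = refl
trim-consTrimmed c       (r ∷ rs) eq = trans (trim-∷ c (r ∷ rs)) (cong (consTrimmed c) eq)

trim-idempotent : ∀ cs → trim (trim cs) ≡ trim cs
trim-idempotent []       = refl
trim-idempotent (c ∷ cs) rewrite trim-∷ c cs =
  trim-consTrimmed c (trim cs) (trim-idempotent cs)

consTrimmed-incCol : ∀ c k cs → consTrimmed c (incCol (suc k) cs) ≡ c ∷ incCol (suc k) cs
consTrimmed-incCol c zero    []      = refl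
consTrimmed-incCol c zero    (_ ∷ _) = refl
consTrimmed-incCol c (suc k) []      = refl
consTrimmed-incCol c (suc k) (_ ∷ _) = refl

trim-∷-incCol : ∀ c k cs → trim (incCol (suc k) cs) ≡ incCol (suc k) cs →
                trim (c ∷ incCol (suc k) cs) ≡ c ∷ incCol (suc k) cs
trim-∷-incCol c k cs eq = begin
  trim (c ∷ incCol (suc k) cs)              ≡⟨ trim-∷ c (incCol (suc k) cs) ⟩
  consTrimmed c (trim (incCol (suc k) cs))  ≡⟨ cong (consTrimmed c) eq ⟩
  consTrimmed c (incCol (suc k) cs)         ≡⟨ consTrimmed-incCol c k cs ⟩
  c ∷ incCol (suc k) cs                     ∎
  where open ≡-Reasoning

trim-incCol-positive : ∀ k {cs} → All (0 <_) cs → trim (incCol (suc k) cs) ≡ incCol (suc k) cs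
trim-incCol-positive zero    []                = refl
trim-incCol-positive zero    {c ∷ cs} (_ ∷ ps) = trim-positive (s≤s z≤n ∷ ps)
trim-incCol-positive (suc k) {[]}     []       = trim-∷-incCol 0 k [] (trim-incCol-positive k [])
trim-incCol-positive (suc k) {c ∷ cs} (_ ∷ ps) = trim-∷-incCol c k cs (trim-incCol-positive k ps)

incCol-consTrimmed : ∀ k c cs → trim (incCol (suc k) (consTrimmed c cs)) ≡ trim (incCol (suc k) (c ∷ cs))
incCol-consTrimmed k       c       (_ ∷ _) = refl
incCol-consTrimmed zero    zero    []      = refl
incCol-consTrimmed (suc k) zero    []      = refl
incCol-consTrimmed k       (suc c) []      = refl

trim-incCol-trim : ∀ k cs → trim (incCol (suc k) (trim cs)) ≡ trim (incCol (suc k) cs)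
trim-incCol-trim k       []       = refl
trim-incCol-trim k       (c ∷ cs) rewrite trim-∷ c cs = trans (incCol-consTrimmed k c (trim cs)) (shift k)
  where
  shift : ∀ k → trim (incCol (suc k) (c ∷ trim cs)) ≡ trim (incCol (suc k) (c ∷ cs))
  shift zero    = begin
    trim (suc c ∷ trim cs)                ≡⟨ trim-∷ (suc c) (trim cs) ⟩
    consTrimmed (suc c) (trim (trim cs))  ≡⟨ cong (consTrimmed (suc c)) (trim-idempotent cs) ⟩
    consTrimmed (suc c) (trim cs)         ≡⟨ trim-∷ (suc c) cs ⟨
    trim (suc c ∷ cs)                     ∎
    where open ≡-Reasoning
  shift (suc k) = trim-cong-∷ c (incCol (suc k) (trim cs)) (incCol (suc k) cs) (trim-incCol-trim k cs)

decCol-incCol : ∀ k cs → ∃ λ ds → decCol (suc k) (incCol (suc k) cs) ≡ just ds × trim ds ≡ trim cs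
decCol-incCol zero    []       = 0 ∷ [] , refl , refl
decCol-incCol zero    (c ∷ cs) = c ∷ cs , refl , refl
decCol-incCol (suc k) []       with decCol-incCol k []
... | ds , eq , tr rewrite eq = 0 ∷ ds , refl , trim-cong-∷ 0 ds [] tr
decCol-incCol (suc k) (c ∷ cs) with decCol-incCol k cs
... | ds , eq , tr rewrite eq = c ∷ ds , refl , trim-cong-∷ c ds cs tr

incCol-decCol : ∀ k {cs ds} → decCol (suc k) cs ≡ just ds → incCol (suc k) ds ≡ cs
incCol-decCol zero    {suc c ∷ cs} refl = refl
incCol-decCol (suc k) {c ∷ cs} eq with decCol (suc k) cs in dec
incCol-decCol (suc k) {c ∷ cs} refl | just ds = cong (c ∷_) (incCol-decCol k dec)

check-sound : ∀ cs {μ} → check cs ≡ just μ → cs ≡ μ × IsPartition μ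
check-sound cs eq with isPartition? cs
check-sound cs refl | yes p = refl , p

check-complete : ∀ {cs} → IsPartition cs → check cs ≡ just cs
check-complete {cs} p with isPartition? cs
... | yes _ = refl
... | no ¬p = ⊥-elim (¬p p)

uOp⇒dOp : ∀ k {λ' μ} → IsPartition λ' → uOp (suc k) λ' ≡ just μ → dOp (suc k) μ ≡ just λ'
uOp⇒dOp k {λ'} p eq with check-sound (trim (incCol (suc k) λ')) eq
... | trimmed , _ with trans (sym (trim-incCol-positive k (proj₁ p))) trimmed
... | refl with decCol-incCol k λ'
... | ds , dec , tr rewrite dec | tr | trim-positive (proj₁ p) = check-complete p

dOp⇒uOp : ∀ k {λ' μ} → IsPartition λ' → dOp (suc k) λ' ≡ just μ → uOp (suc k) μ ≡ just λ'
dOp⇒uOp k {λ'} p eq with decCol (suc k) λ' in dec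
dOp⇒uOp k {λ'} p eq | just ds with check-sound (trim ds) eq
... | refl , _ rewrite trim-incCol-trim k ds | incCol-decCol k dec | trim-positive (proj₁ p) =
  check-complete p

letterOp-partition : ∀ t l cs {μ} → letterOp t l cs ≡ just μ → IsPartition μ
letterOp-partition t U cs eq = proj₂ (check-sound _ eq)
letterOp-partition t D cs eq with decCol t cs
... | just _ = proj₂ (check-sound _ eq)

>>=-assoc : ∀ {A B C : Set} (m : Maybe A) (f : A → Maybe B) (g : B → Maybe C) →
            ((m >>= f) >>= g) ≡ (m >>= λ x → f x >>= g)
>>=-assoc (just _) f g = refl
>>=-assoc nothing  f g = refl

act-++ : ∀ t v w cs → act t (v ++ w) cs ≡ (act t w cs >>= act t v)
act-++ t []      w cs with act t w cs
... | just _  = refl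
... | nothing = refl
act-++ t (l ∷ v) w cs = trans (cong (_>>= letterOp t l) (act-++ t v w cs))
                              (>>=-assoc (act t w cs) (act t v) (letterOp t l))

act-partition : ∀ t w {cs μ} → IsPartition cs → act t w cs ≡ just μ → IsPartition μ
act-partition t []      p refl = p
act-partition t (l ∷ w) {cs} p eq with act t w cs
... | just ν = letterOp-partition t l ν eq

act-replicate-suc : ∀ t l n cs →
                    act t (replicate (suc n) l) cs ≡ (letterOp t l cs >>= act t (replicate n l))
act-replicate-suc t l zero    cs with letterOp t l cs
... | just _  = refl
... | nothing = refl
act-replicate-suc t l (suc n) cs =
  trans (cong (_>>= letterOp t l) (act-replicate-suc t l n cs))
        (>>=-assoc (letterOp t l cs) (act t (replicate n l)) (letterOp t l))

Uⁿ-after-Dⁿ : ∀ k n {λ' ν} → IsPartition λ' → act (suc k) (replicate n D) λ' ≡ just ν →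
              act (suc k) (replicate n U) ν ≡ just λ'
Uⁿ-after-Dⁿ k zero    p refl = refl
Uⁿ-after-Dⁿ k (suc n) {λ'} {ν} p eq with act (suc k) (replicate n D) λ' in rest
... | just ρ = begin
  act t (replicate (suc n) U) ν      ≡⟨ act-replicate-suc t U n ν ⟩
  (uOp t ν >>= act t (replicate n U)) ≡⟨ cong (_>>= act t (replicate n U)) (dOp⇒uOp k ρ-partition eq) ⟩
  act t (replicate n U) ρ            ≡⟨ Uⁿ-after-Dⁿ k n p rest ⟩
  just λ'                            ∎
  where
  open ≡-Reasoning
  t = suc k
  ρ-partition : IsPartition ρ
  ρ-partition = act-partition t (replicate n D) p rest

uⁱ⁺¹dⁱ≡uⁱ⁺¹dⁱ⁺¹u : ∀ k i {λ'} → IsPartition λ' →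
  act (suc k) (replicate (suc i) U ++ replicate i D) λ' ≡
  act (suc k) (replicate (suc i) U ++ replicate (suc i) D ++ U ∷ []) λ'
uⁱ⁺¹dⁱ≡uⁱ⁺¹dⁱ⁺¹u k i {λ'} p = begin
  act t (Uⁱ⁺¹ ++ Dⁱ) λ'                            ≡⟨ act-++ t Uⁱ⁺¹ Dⁱ λ' ⟩
  (act t Dⁱ λ' >>= act t Uⁱ⁺¹)                     ≡⟨ middle ⟩
  ((uOp t λ' >>= act t Dⁱ⁺¹) >>= act t Uⁱ⁺¹)       ≡⟨ cong (_>>= act t Uⁱ⁺¹) (act-++ t Dⁱ⁺¹ (U ∷ []) λ') ⟨
  (act t (Dⁱ⁺¹ ++ U ∷ []) λ' >>= act t Uⁱ⁺¹)       ≡⟨ act-++ t Uⁱ⁺¹ (Dⁱ⁺¹ ++ U ∷ []) λ' ⟨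
  act t (Uⁱ⁺¹ ++ Dⁱ⁺¹ ++ U ∷ []) λ'                ∎
  where
  open ≡-Reasoning
  t = suc k
  Dⁱ = replicate i D
  Dⁱ⁺¹ = replicate (suc i) D
  Uⁱ⁺¹ = replicate (suc i) U
  middle : (act t Dⁱ λ' >>= act t Uⁱ⁺¹) ≡ ((uOp t λ' >>= act t Dⁱ⁺¹) >>= act t Uⁱ⁺¹)
  middle with uOp t λ' in up
  ... | just μ = cong (_>>= act t Uⁱ⁺¹) (sym (trans (act-replicate-suc t D i μ)
                                                    (cong (_>>= act t Dⁱ) (uOp⇒dOp k p up))))
  ... | nothing with act t Dⁱ λ' in down
  ...   | nothing = refl
  ...   | just ν  = trans (cong (_>>= uOp t) (Uⁿ-after-Dⁿ k i p down)) up

uⁱdⁱ⁺¹≡duⁱ⁺¹dⁱ⁺¹ : ∀ k i {λ'} → IsPartition λ' →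
  act (suc k) (replicate i U ++ replicate (suc i) D) λ' ≡
  act (suc k) (D ∷ replicate (suc i) U ++ replicate (suc i) D) λ'
uⁱdⁱ⁺¹≡duⁱ⁺¹dⁱ⁺¹ k i {λ'} p = begin
  act t (Uⁱ ++ Dⁱ⁺¹) λ'                            ≡⟨ act-++ t Uⁱ Dⁱ⁺¹ λ' ⟩
  (act t Dⁱ⁺¹ λ' >>= act t Uⁱ)                     ≡⟨ middle ⟩
  ((act t Dⁱ⁺¹ λ' >>= act t Uⁱ⁺¹) >>= dOp t)       ≡⟨ cong (_>>= dOp t) (act-++ t Uⁱ⁺¹ Dⁱ⁺¹ λ') ⟨
  act t (D ∷ Uⁱ⁺¹ ++ Dⁱ⁺¹) λ'                      ∎
  where
  open ≡-Reasoning
  t = suc k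
  Uⁱ = replicate i U
  Uⁱ⁺¹ = replicate (suc i) U
  Dⁱ⁺¹ = replicate (suc i) D
  middle : (act t Dⁱ⁺¹ λ' >>= act t Uⁱ) ≡ ((act t Dⁱ⁺¹ λ' >>= act t Uⁱ⁺¹) >>= dOp t)
  middle with act t Dⁱ⁺¹ λ' in down
  ... | nothing = refl
  ... | just ν with act t Uⁱ ν in up | Uⁿ-after-Dⁿ k (suc i) p down
  ...   | just μ | back = sym (trans (cong (_>>= dOp t) back) (uOp⇒dOp k μ-partition back))
    where
    μ-partition : IsPartition μ
    μ-partition = act-partition t Uⁱ (act-partition t Dⁱ⁺¹ p down) up

run : ℕ → Word → Maybe (List ℕ) → Maybe (List ℕ)
run t w m = m >>= act t w

run-++ : ∀ t v w m → run t (v ++ w) m ≡ run t v (run t w m)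
run-++ t v w nothing   = refl
run-++ t v w (just cs) = act-++ t v w cs

run-partition : ∀ t w {m} → MaybeAll.All IsPartition m → MaybeAll.All IsPartition (run t w m)
run-partition t w nothing = nothing
run-partition t w {just cs} (just p) with act t w cs in eq
... | just μ  = just (act-partition t w p eq)
... | nothing = nothing

run-genA-words : ∀ k i {m} → MaybeAll.All IsPartition m →
  run (suc k) (replicate (suc i) U ++ replicate i D) m ≡
  run (suc k) (replicate (suc i) U ++ replicate (suc i) D ++ U ∷ []) m
run-genA-words k i nothing  = refl
run-genA-words k i (just p) = uⁱ⁺¹dⁱ≡uⁱ⁺¹dⁱ⁺¹u k i p

run-genB-words : ∀ k i {m} → MaybeAll.All IsPartition m →
  run (suc k) (replicate i U ++ replicate (suc i) D) m ≡
  run (suc k) (D ∷ replicate (suc i) U ++ replicate (suc i) D) m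
run-genB-words k i nothing  = refl
run-genB-words k i (just p) = uⁱdⁱ⁺¹≡duⁱ⁺¹dⁱ⁺¹ k i p

module Linear {c ℓ : Level} (R : CommutativeRing c ℓ) where
  open CommutativeRing R renaming (refl to ≈-refl; sym to ≈-sym; trans to ≈-trans)
  open import Relation.Binary.Reasoning.Setoid setoid
  open import Algebra.Properties.Ring ring using (-1*x≈-x)
  open import Algebra.Properties.CommutativeSemigroup +-commutativeSemigroup using (interchange)

  linExt : (Word → Carrier) → Elem R → Carrier
  linExt h []            = 0#
  linExt h ((r , w) ∷ f) = r * h w + linExt h f

  linExt-cong : ∀ f {g h} → (∀ w → g w ≈ h w) → linExt g f ≈ linExt h f
  linExt-cong []            eq = ≈-refl
  linExt-cong ((r , w) ∷ f) eq = +-cong (*-cong ≈-refl (eq w)) (linExt-cong f eq)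

  linExt-zero : ∀ f {h} → (∀ w → h w ≈ 0#) → linExt h f ≈ 0#
  linExt-zero []            eq = ≈-refl
  linExt-zero ((r , w) ∷ f) eq = begin
    r * _ + linExt _ f  ≈⟨ +-cong (≈-trans (*-cong ≈-refl (eq w)) (zeroʳ r)) (linExt-zero f eq) ⟩
    0# + 0#             ≈⟨ +-identityʳ 0# ⟩
    0#                  ∎

  linExt-++ : ∀ h f g → linExt h (f ++ g) ≈ linExt h f + linExt h g
  linExt-++ h []            g = ≈-sym (+-identityˡ _)
  linExt-++ h ((r , w) ∷ f) g = ≈-trans (+-cong ≈-refl (linExt-++ h f g)) (≈-sym (+-assoc _ _ _))

  linExt-+ : ∀ g h f → linExt g f + linExt h f ≈ linExt (λ w → g w + h w) f
  linExt-+ g h []            = +-identityʳ 0#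
  linExt-+ g h ((r , w) ∷ f) =
    ≈-trans (interchange _ _ _ _) (+-cong (≈-sym (distribˡ r _ _)) (linExt-+ g h f))

  linExt-* : ∀ r h f → r * linExt h f ≈ linExt (λ w → r * h w) f
  linExt-* r h []            = zeroʳ r
  linExt-* r h ((s , w) ∷ f) = ≈-trans (distribˡ r _ _) (+-cong (x*[y*z]≈y*[x*z] r s _) (linExt-* r h f))
    where
    x*[y*z]≈y*[x*z] : ∀ x y z → x * (y * z) ≈ y * (x * z)
    x*[y*z]≈y*[x*z] x y z =
      ≈-trans (≈-sym (*-assoc x y z)) (≈-trans (*-cong (*-comm x y) ≈-refl) (*-assoc y x z))

  linExt-map : ∀ r v h g → linExt h (map (λ { (s , w) → (r * s , v ++ w) }) g) ≈ r * linExt (h ∘ (v ++_)) g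
  linExt-map r v h []            = ≈-sym (zeroʳ r)
  linExt-map r v h ((s , w) ∷ g) = ≈-trans (+-cong (*-assoc r s _) (linExt-map r v h g)) (≈-sym (distribˡ r _ _))

  linExt-⊗ : ∀ h f g → linExt h (_⊗_ R f g) ≈ linExt (λ v → linExt (h ∘ (v ++_)) g) f
  linExt-⊗ h []            g = ≈-refl
  linExt-⊗ h ((r , v) ∷ f) g =
    ≈-trans (linExt-++ h (map (λ { (s , w) → (r * s , v ++ w) }) g) (_⊗_ R f g))
            (+-cong (linExt-map r v h g) (linExt-⊗ h f g))

  linExt-swap : ∀ f g (K : Word → Word → Carrier) →
                linExt (λ v → linExt (K v) g) f ≈ linExt (λ w → linExt (λ v → K v w) f) g
  linExt-swap []            g K = ≈-sym (linExt-zero g (λ _ → ≈-refl))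
  linExt-swap ((r , v) ∷ f) g K = begin
    r * linExt (K v) g + linExt (λ v → linExt (K v) g) f
      ≈⟨ +-cong (linExt-* r (K v) g) (linExt-swap f g K) ⟩
    linExt (λ w → r * K v w) g + linExt (λ w → linExt (λ v → K v w) f) g
      ≈⟨ linExt-+ _ _ g ⟩
    linExt (λ w → r * K v w + linExt (λ v → K v w) f) g ∎

  -- Quantifying over every h : Q → Carrier says that f·q vanishes in the free R-module on Q.
  module Kernel {Q : Set} (Valid : Q → Set)
                (run : Word → Q → Q) (run-++ : ∀ v w q → run (v ++ w) q ≡ run v (run w q))
                (run-valid : ∀ w {q} → Valid q → Valid (run w q)) where

    Annihilates : Elem R → Set _
    Annihilates f = ∀ q → Valid q → (h : Q → Carrier) → linExt (λ w → h (run w q)) f ≈ 0#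

    annihilates-difference : ∀ v w → (∀ q → Valid q → run v q ≡ run w q) →
                             Annihilates ((1# , v) ∷ (- 1# , w) ∷ [])
    annihilates-difference v w same q valid h = begin
      1# * h (run v q) + (- 1# * h (run w q) + 0#)
        ≈⟨ +-cong (*-identityˡ _) (≈-trans (+-identityʳ _) (-1*x≈-x _)) ⟩
      h (run v q) - h (run w q)
        ≈⟨ +-cong ≈-refl (-‿cong (reflexive (cong h (sym (same q valid))))) ⟩
      h (run v q) - h (run v q)
        ≈⟨ -‿inverseʳ _ ⟩
      0# ∎

    annihilates-⊕ : ∀ {f g} → Annihilates f → Annihilates g → Annihilates (_⊕_ R f g)
    annihilates-⊕ {f} {g} af ag q valid h =
      ≈-trans (linExt-++ _ f g) (≈-trans (+-cong (af q valid h) (ag q valid h)) (+-identityʳ 0#))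

    annihilates-⊗ˡ : ∀ a {f} → Annihilates f → Annihilates (_⊗_ R a f)
    annihilates-⊗ˡ a {f} af q valid h =
      ≈-trans (linExt-⊗ _ a f) (linExt-zero a λ v →
        ≈-trans (linExt-cong f λ w → reflexive (cong h (run-++ v w q)))
                (af q valid (h ∘ run v)))

    annihilates-⊗ʳ : ∀ a {f} → Annihilates f → Annihilates (_⊗_ R f a)
    annihilates-⊗ʳ a {f} af q valid h =
      ≈-trans (linExt-⊗ _ f a) (≈-trans (linExt-swap f a _) (linExt-zero a λ w →
        ≈-trans (linExt-cong f λ v → reflexive (cong h (run-++ v w q)))
                (af (run w q) (run-valid w valid) h)))

  δ : List ℕ → Maybe (List ℕ) → Carrier
  δ μ m with MaybeP.≡-dec (ListP.≡-dec ℕP._≟_) m (just μ)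
  ... | yes _ = 1#
  ... | no _  = 0#

  coeff≈linExt-δ : ∀ t f λ' μ → coeff R t f λ' μ ≈ linExt (λ w → δ μ (act t w λ')) f
  coeff≈linExt-δ t []            λ' μ = ≈-refl
  coeff≈linExt-δ t ((r , w) ∷ f) λ' μ with MaybeP.≡-dec (ListP.≡-dec ℕP._≟_) (act t w λ') (just μ)
  ... | yes _ = +-cong (≈-sym (*-identityʳ r)) (coeff≈linExt-δ t f λ' μ)
  ... | no _  = ≈-trans (coeff≈linExt-δ t f λ' μ) (≈-sym (≈-trans (+-cong (zeroʳ r) ≈-refl) (+-identityˡ _)))

  module _ (k : ℕ) where
    open Kernel (MaybeAll.All IsPartition) (run (suc k)) (run-++ (suc k)) (run-partition (suc k))

    InJ⇒Annihilates : ∀ {f} → InJ R f → Annihilates f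
    InJ⇒Annihilates (inA i)             = annihilates-difference (replicate (suc i) U ++ replicate i D)
                                             (replicate (suc i) U ++ replicate (suc i) D ++ U ∷ [])
                                             λ _ → run-genA-words k i
    InJ⇒Annihilates (inB i)             = annihilates-difference (replicate i U ++ replicate (suc i) D)
                                             (D ∷ replicate (suc i) U ++ replicate (suc i) D)
                                             λ _ → run-genB-words k i
    InJ⇒Annihilates in0                 = λ _ _ _ → ≈-refl
    InJ⇒Annihilates (inAdd {f} {g} x y) = annihilates-⊕ {f} {g} (InJ⇒Annihilates x) (InJ⇒Annihilates y)
    InJ⇒Annihilates (inL a {f} x)       = annihilates-⊗ˡ a {f} (InJ⇒Annihilates x)
    InJ⇒Annihilates (inR {f} a x)       = annihilates-⊗ʳ a {f} (InJ⇒Annihilates x)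

proposition4p6 : {c ℓ : Level} (R : CommutativeRing c ℓ) (t : ℕ) → 1 < t →
                   (f : Elem R) → InJ R f → ActsAsZero R t f
proposition4p6 R (suc k) _ f f∈J λ' p μ =
  CommutativeRing.trans R (coeff≈linExt-δ (suc k) f λ' μ)
                          (InJ⇒Annihilates k f∈J (just λ') (just p) (δ μ))
  where open Linear R
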